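{- Let $n>1$ be an integer that is either odd, or even and not squarefree. Then $(1,n^{(n-1)k}-1,n^{(n-1)k})$ is an $abc$ triple for each positive integer $k$.
   Context: For a positive integer $n$, $\operatorname{rad}(n)$ denotes the product of the distinct prime factors of $n$. An $abc$ triple is a triple $(a,b,c)$ of relatively prime positive integers with $a+b=c$ and $\operatorname{rad}(abc)<c$. -}

module Defs where

open import Data.Nat using (ℕ; zero; suc; _+_; _*_; _^_; _<_)
open import Data.Nat.Divisibility using (_∣_; _∣?_)
open import Data.Nat.Primality using (Prime; prime?)
open import Data.Nat.Coprimality using (Coprime)
open import Data.List using (List; filter; upTo)
open import Data.Nat.ListAction using (product)
open import Relation.Binary.PropositionalEquality using (_≡_)
open import Data.Product using (_×_)
open import Relation.Nullary using (¬_)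
open import Relation.Nullary.Decidable using (_×-dec_)

-- rad(n): product of the distinct primes dividing n.
-- Primes dividing n ≥ 1 are ≤ n, so we range over p ∈ {0,…,n} (p = 0 is not prime).
-- Convention: rad 0 = 1 (never used below).
rad : ℕ → ℕ
rad n = product (filter (λ p → prime? p ×-dec (p ∣? n)) (upTo (suc n)))

SquareFree : ℕ → Set
SquareFree n = ∀ p → Prime p → ¬ (p * p ∣ n)

Odd : ℕ → Set
Odd n = ¬ (2 ∣ n)

IsAbcTriple : ℕ → ℕ → ℕ → Set
IsAbcTriple a b c =
  (0 < a × 0 < b × 0 < c) ×
  (Coprime a b × Coprime a c × Coprime b c) ×
  (a + b ≡ c) × (rad (a * b * c) < c)

-- Write n = 1 + d and c = n ^ (d k). Expanding (1 + d) ^ (d k) shows c ≡ 1 mod d², so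
-- b = c - 1 = d² H with H ≥ k. If q² ∣ n for a prime q, every prime factor of n divides
-- r = n / q ≤ d, hence rad(b c) ≤ r · d H ≤ d² H = b. If n is odd, d = 2u and c = x² with
-- x = n ^ (u k) = 1 + 2t, t = u² H'; then b = 4 t (t + 1), and since t (t + 1) is even,
-- rad(b c) ≤ n · u H' (t + 1) ≤ 4u · u H' (t + 1) = b.
module Submission where

open import Defs
open import Data.Nat
  using (ℕ; zero; suc; _+_; _<_; _≤_; _∸_; _*_; _^_; s≤s; z<s; >-nonZero; >-nonZero⁻¹; nonTrivial⇒n>1)
open import Data.Nat.Properties
open import Data.Nat.Divisibility
open import Data.Nat.Primality
open import Data.Nat.Coprimality using (Coprime; coprime-divisor; 1-coprimeTo)
open import Data.Nat.ListAction using (product)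
open import Data.Nat.Tactic.RingSolver using (solve-∀)
open import Data.List using (_∷_; filter; upTo)
open import Data.List.Relation.Unary.All as All using (All; []; _∷_)
open import Data.List.Relation.Unary.All.Properties using (all-filter)
open import Data.List.Relation.Unary.AllPairs using ([]; _∷_)
open import Data.List.Relation.Unary.Unique.Propositional using (Unique)
open import Data.List.Relation.Unary.Unique.Propositional.Properties using (upTo⁺; filter⁺)
open import Data.Sum using (_⊎_; inj₁; inj₂)
open import Data.Product using (_×_; _,_; proj₁; ∃-syntax)
open import Data.Empty using (⊥-elim)
open import Relation.Nullary using (¬_; yes; no)
open import Relation.Nullary.Decidable using (_×-dec_)
open import Relation.Binary.PropositionalEquality

m*n>0 : ∀ {m n} → 0 < m → 0 < n → 0 < m * n
m*n>0 {suc _} {suc _} _ _ = z<s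

PrimeFactorsDivide : ℕ → ℕ → Set
PrimeFactorsDivide x y = ∀ {p} → Prime p → p ∣ x → p ∣ y

∣⇒primeFactorsDivide : ∀ {x y} → x ∣ y → PrimeFactorsDivide x y
∣⇒primeFactorsDivide x∣y _ p∣x = ∣-trans p∣x x∣y

primeFactorsDivide-∣ : ∀ {x y z} → PrimeFactorsDivide x y → y ∣ z → PrimeFactorsDivide x z
primeFactorsDivide-∣ xy y∣z p-prime p∣x = ∣-trans (xy p-prime p∣x) y∣z

primeFactorsDivide-trans : ∀ {x y z} → PrimeFactorsDivide x y → PrimeFactorsDivide y z →
                           PrimeFactorsDivide x z
primeFactorsDivide-trans xy yz p-prime p∣x = yz p-prime (xy p-prime p∣x)

primeFactorsDivide-* : ∀ {x y z} → PrimeFactorsDivide x z → PrimeFactorsDivide y z →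
                       PrimeFactorsDivide (x * y) z
primeFactorsDivide-* {x} {y} xz yz p-prime p∣xy with euclidsLemma x y p-prime p∣xy
... | inj₁ p∣x = xz p-prime p∣x
... | inj₂ p∣y = yz p-prime p∣y

primeFactorsDivide-^ : ∀ m e → PrimeFactorsDivide (m ^ e) m
primeFactorsDivide-^ m zero    = ∣⇒primeFactorsDivide (1∣ m)
primeFactorsDivide-^ m (suc e) =
  primeFactorsDivide-* (∣⇒primeFactorsDivide ∣-refl) (primeFactorsDivide-^ m e)

prime⇒>1 : ∀ {p} → Prime p → 1 < p
prime⇒>1 {p} p-prime = nonTrivial⇒n>1 p {{prime⇒nonTrivial p-prime}}

prime∣prime⇒≡ : ∀ {p q} → Prime p → Prime q → p ∣ q → p ≡ q
prime∣prime⇒≡ p-prime q-prime p∣q with prime⇒irreducible q-prime p∣q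
... | inj₁ refl = ⊥-elim (¬prime[1] p-prime)
... | inj₂ p≡q  = p≡q

prime∤⇒coprime : ∀ {p n} → Prime p → ¬ p ∣ n → Coprime p n
prime∤⇒coprime p-prime p∤n (i∣p , i∣n) with prime⇒irreducible p-prime i∣p
... | inj₁ i≡1 = i≡1
... | inj₂ refl = ⊥-elim (p∤n i∣n)

prime∤product : ∀ {p qs} → Prime p → All Prime qs → All (p ≢_) qs → ¬ p ∣ product qs
prime∤product p-prime []                 []           p∣1 = ¬prime[1] (subst Prime (∣1⇒≡1 p∣1) p-prime)
prime∤product p-prime (q-prime ∷ primes) (p≢q ∷ p≢qs) p∣qQs with euclidsLemma _ _ p-prime p∣qQs
... | inj₁ p∣q  = p≢q (prime∣prime⇒≡ p-prime q-prime p∣q)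
... | inj₂ p∣Qs = prime∤product p-prime primes p≢qs p∣Qs

product-∣ : ∀ {qs n} → Unique qs → All Prime qs → All (_∣ n) qs → product qs ∣ n
product-∣ {n = n} []             []                 []           = 1∣ n
product-∣ {q ∷ qs} {n} (q∉qs ∷ uniq) (q-prime ∷ primes) (q∣n ∷ qs∣n)
  with product-∣ uniq primes qs∣n
... | divides e n≡e*Qs = divides (quotient q∣e) (begin
    n                               ≡⟨ n≡e*Qs ⟩
    e * product qs                  ≡⟨ cong (_* product qs) (_∣_.equality q∣e) ⟩
    quotient q∣e * q * product qs   ≡⟨ *-assoc (quotient q∣e) q (product qs) ⟩
    quotient q∣e * product (q ∷ qs) ∎)
  where
  open ≡-Reasoning
  q∣e : q ∣ e
  q∣e = coprime-divisor (prime∤⇒coprime q-prime (prime∤product q-prime primes q∉qs))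
                        (subst (q ∣_) (trans n≡e*Qs (*-comm e (product qs))) q∣n)

rad-≤ : ∀ {x D} → 0 < D → PrimeFactorsDivide x D → rad x ≤ D
rad-≤ {x} {D@(suc _)} _ xD = ∣⇒≤ (product-∣ (filter⁺ P? (upTo⁺ (suc x)))
                                             (All.map proj₁ primeDivisors)
                                             (All.map (λ (p-prime , p∣x) → xD p-prime p∣x) primeDivisors))
  where
  P? = λ p → prime? p ×-dec (p ∣? x)
  primeDivisors = all-filter P? (upTo (suc x))

coprime-suc : ∀ n → Coprime n (suc n)
coprime-suc n {i} (i∣n , i∣1+n) = ∣1⇒≡1 (∣m+n∣m⇒∣n (subst (i ∣_) (+-comm 1 n) i∣1+n) i∣n)

2∣n⊎2∣1+n : ∀ n → 2 ∣ n ⊎ 2 ∣ suc n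
2∣n⊎2∣1+n zero = inj₁ (2 ∣0)
2∣n⊎2∣1+n (suc n) with 2∣n⊎2∣1+n n
... | inj₁ 2∣n   = inj₂ (∣m∣n⇒∣m+n ∣-refl 2∣n)
... | inj₂ 2∣1+n = inj₁ 2∣1+n

2∣n*[1+n] : ∀ n → 2 ∣ n * suc n
2∣n*[1+n] n with 2∣n⊎2∣1+n n
... | inj₁ 2∣n   = ∣m⇒∣m*n (suc n) 2∣n
... | inj₂ 2∣1+n = ∣n⇒∣m*n n 2∣1+n

[1+d]^i≡1+d*[i+d*K] : ∀ d i → ∃[ K ] suc d ^ i ≡ suc (d * (i + d * K))
[1+d]^i≡1+d*[i+d*K] d zero = 0 , cong suc (sym (trans (cong (d *_) (*-zeroʳ d)) (*-zeroʳ d)))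
[1+d]^i≡1+d*[i+d*K] d (suc i) with [1+d]^i≡1+d*[i+d*K] d i
... | K , eq = K + i + d * K , trans (cong (suc d *_) eq) (step d i K)
  where
  step : ∀ d i K → suc d * suc (d * (i + d * K)) ≡ suc (d * (suc i + d * (K + i + d * K)))
  step = solve-∀

[1+d]^[e*k]≡1+d*e*H : ∀ {d e} k → e ∣ d → ∃[ H ] k ≤ H × suc d ^ (e * k) ≡ suc (d * (e * H))
[1+d]^[e*k]≡1+d*e*H {e = e} k (divides f refl) with [1+d]^i≡1+d*[i+d*K] (f * e) (e * k)
... | K , eq = k + f * K , m≤m+n k (f * K) , trans eq (regroup f e k K)
  where
  regroup : ∀ f e k K → suc (f * e * (e * k + f * e * K)) ≡ suc (f * e * (e * (k + f * K)))
  regroup = solve-∀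

abcTriple-1 : ∀ {c b} D → c ≡ suc b → 0 < D → D ≤ b →
              PrimeFactorsDivide b D → PrimeFactorsDivide c D → IsAbcTriple 1 (c ∸ 1) c
abcTriple-1 {b = b} D refl 0<D D≤b bD cD =
  (z<s , ≤-trans 0<D D≤b , z<s) ,
  (1-coprimeTo b , 1-coprimeTo (suc b) , coprime-suc b) ,
  refl ,
  s≤s (≤-trans (rad-≤ 0<D abcD) D≤b)
  where
  abcD : PrimeFactorsDivide (1 * b * suc b) D
  abcD = primeFactorsDivide-* (primeFactorsDivide-* (∣⇒primeFactorsDivide (1∣ D)) bD) cD

abcTriple-rad< : ∀ {d r} → 0 < r → r ≤ d → PrimeFactorsDivide (suc d) r →
                 ∀ {k} → 0 < k → IsAbcTriple 1 (suc d ^ (d * k) ∸ 1) (suc d ^ (d * k))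
abcTriple-rad< {d} {r} 0<r r≤d nr {k} 0<k with [1+d]^[e*k]≡1+d*e*H {d} {d} k ∣-refl
... | H , k≤H , c≡ = abcTriple-1 (r * (d * H)) c≡ 0<D (*-monoˡ-≤ (d * H) r≤d) bD cD
  where
  0<D : 0 < r * (d * H)
  0<D = m*n>0 0<r (m*n>0 (≤-trans 0<r r≤d) (≤-trans 0<k k≤H))
  bD : PrimeFactorsDivide (d * (d * H)) (r * (d * H))
  bD = primeFactorsDivide-∣ (primeFactorsDivide-* (∣⇒primeFactorsDivide (m∣m*n {d} H))
                                                 (∣⇒primeFactorsDivide ∣-refl))
                            (n∣m*n r {d * H})
  cD : PrimeFactorsDivide (suc d ^ (d * k)) (r * (d * H))
  cD = primeFactorsDivide-trans (primeFactorsDivide-^ (suc d) (d * k))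
                                (primeFactorsDivide-∣ nr (m∣m*n {r} (d * H)))

¬SquareFree⇒∃prime-square-∣ : ∀ {n} → 0 < n → ¬ SquareFree n → ∃[ q ] Prime q × q * q ∣ n
¬SquareFree⇒∃prime-square-∣ {n} 0<n ¬sqf with anyUpTo? (λ q → prime? q ×-dec (q * q ∣? n)) (suc n)
... | yes (q , _ , q-prime , q²∣n) = q , q-prime , q²∣n
... | no ∄q = ⊥-elim (¬sqf λ q q-prime q²∣n → ∄q (q , s≤s (q≤n q-prime q²∣n) , q-prime , q²∣n))
  where
  q≤n : ∀ {q} → Prime q → q * q ∣ n → q ≤ n
  q≤n {q} q-prime q²∣n = ≤-trans (m≤m*n q q {{prime⇒nonZero q-prime}}) (∣⇒≤ {{>-nonZero 0<n}} q²∣n)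

¬SquareFree⇒rad< : ∀ {n} → 0 < n → ¬ SquareFree n → ∃[ r ] 0 < r × r < n × PrimeFactorsDivide n r
¬SquareFree⇒rad< 0<n ¬sqf with ¬SquareFree⇒∃prime-square-∣ 0<n ¬sqf
... | q , q-prime , divides zero refl = ⊥-elim (<-irrefl refl 0<n)
... | q , q-prime , divides t@(suc _) refl =
  t * q , 0<tq , tq<n , nr
  where
  0<tq : 0 < t * q
  0<tq = m*n>0 {t} {q} z<s (>-nonZero⁻¹ q {{prime⇒nonZero q-prime}})
  tq<n : t * q < t * (q * q)
  tq<n = subst (t * q <_) (*-assoc t q q) (m<m*n (t * q) q {{>-nonZero 0<tq}} (prime⇒>1 q-prime))
  qTq : PrimeFactorsDivide q (t * q)
  qTq = ∣⇒primeFactorsDivide (n∣m*n t {q})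
  nr : PrimeFactorsDivide (t * (q * q)) (t * q)
  nr = primeFactorsDivide-* (∣⇒primeFactorsDivide (m∣m*n {t} q)) (primeFactorsDivide-* qTq qTq)

abcTriple-2∣ : ∀ {d} → 0 < d → 2 ∣ d →
               ∀ {k} → 0 < k → IsAbcTriple 1 (suc d ^ (d * k) ∸ 1) (suc d ^ (d * k))
abcTriple-2∣ () (divides zero refl)
abcTriple-2∣ _ (divides u@(suc _) refl) {k} 0<k with [1+d]^[e*k]≡1+d*e*H {u * 2} {u} k (m∣m*n 2)
... | H , k≤H , x≡ = abcTriple-1 (n * s) c≡ 0<D D≤b bD cD
  where
  n = suc (u * 2)
  t = u * (u * H)
  s = u * H * suc t
  b = 2 * 2 * (t * suc t)

  c≡ : n ^ (u * 2 * k) ≡ suc b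
  c≡ = begin
    n ^ (u * 2 * k)               ≡⟨ cong (n ^_) (swap u k) ⟩
    n ^ (u * k * 2)               ≡⟨ ^-*-assoc n (u * k) 2 ⟨
    (n ^ (u * k)) ^ 2             ≡⟨ cong (_^ 2) x≡ ⟩
    suc (u * 2 * (u * H)) ^ 2     ≡⟨ square u H ⟩
    suc b                         ∎
    where
    open ≡-Reasoning
    swap : ∀ u k → u * 2 * k ≡ u * k * 2
    swap = solve-∀
    -- x ^ 2 unfolds to x * (x * 1), a form the ring solver accepts.
    square : ∀ u H → let x = suc (u * 2 * (u * H)) in
             x * (x * 1) ≡ suc (2 * 2 * (u * (u * H) * suc (u * (u * H))))
    square = solve-∀

  0<u : 0 < u
  0<u = z<s

  0<D : 0 < n * s
  0<D = m*n>0 {n} {s} z<s (m*n>0 (m*n>0 {u} {H} 0<u (≤-trans 0<k k≤H)) z<s)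

  D≤b : n * s ≤ b
  D≤b = begin
    n * s               ≤⟨ *-monoˡ-≤ s (+-monoˡ-≤ (u * 2) (m*n>0 {u} {2} 0<u z<s)) ⟩
    (u * 2 + u * 2) * s ≡⟨ regroup u H ⟩
    b                   ∎
    where
    open ≤-Reasoning
    regroup : ∀ u H → (u * 2 + u * 2) * (u * H * suc (u * (u * H)))
                      ≡ 2 * 2 * (u * (u * H) * suc (u * (u * H)))
    regroup = solve-∀

  ts : PrimeFactorsDivide t s
  ts = primeFactorsDivide-* (∣⇒primeFactorsDivide (∣m⇒∣m*n (suc t) (m∣m*n {u} H)))
                            (∣⇒primeFactorsDivide (m∣m*n (suc t)))

  tt₊₁s : PrimeFactorsDivide (t * suc t) s
  tt₊₁s = primeFactorsDivide-* ts (∣⇒primeFactorsDivide (n∣m*n (u * H)))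

  2s : PrimeFactorsDivide 2 s
  2s = ∣⇒primeFactorsDivide (tt₊₁s prime[2] (2∣n*[1+n] t))

  bD : PrimeFactorsDivide b (n * s)
  bD = primeFactorsDivide-∣ (primeFactorsDivide-* (primeFactorsDivide-* 2s 2s) tt₊₁s) (n∣m*n n)

  cD : PrimeFactorsDivide (n ^ (u * 2 * k)) (n * s)
  cD = primeFactorsDivide-∣ (primeFactorsDivide-^ n (u * 2 * k)) (m∣m*n s)

corollary3p7 : (n : ℕ) → 1 < n → (Odd n ⊎ ((¬ Odd n) × (¬ SquareFree n))) →
    (k : ℕ) → 0 < k →
    IsAbcTriple 1 (n ^ ((n ∸ 1) * k) ∸ 1) (n ^ ((n ∸ 1) * k))
corollary3p7 (suc d) (s≤s 0<d) (inj₁ odd) k 0<k with 2∣n⊎2∣1+n d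
... | inj₁ 2∣d = abcTriple-2∣ 0<d 2∣d 0<k
... | inj₂ 2∣n = ⊥-elim (odd 2∣n)
corollary3p7 (suc d) (s≤s 0<d) (inj₂ (_ , ¬sqf)) k 0<k with ¬SquareFree⇒rad< z<s ¬sqf
... | r , 0<r , r<n , nr = abcTriple-rad< 0<r (≤-pred r<n) nr 0<k
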